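{- Let $H$ and $G$ be graphs with $\delta(G)=\delta$ and $|V(H)|=n$. Then $$\chi_G^L(H)\leq \left\lceil \frac{n}{\delta}\right\rceil.$$
   Context: All graphs are finite, simple and undirected. $H$ is $G$-free if it contains no subgraph isomorphic to $G$. A list assignment $L$ assigns to each vertex $v$ a set $L(v)$ of colors; an $L$-$G$-free coloring is a map $c$ with $c(v)\in L(v)$ for all $v$ such that each color class induces a $G$-free subgraph. $\chi_G^L(H)$ is the least $k$ such that $H$ has an $L$-$G$-free coloring for every list assignment $L$ with $|L(v)|\ge k$ for all $v$. $\delta(G)$ is the minimum degree of $G$. -}

module Defs where

open import Data.Nat using (ℕ; zero; suc; _+_; _∸_; _≤_; NonZero)
open import Data.Nat.DivMod using (_/_)
open import Data.Bool using (Bool; true; false; if_then_else_)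
open import Data.Fin using (Fin)
open import Data.List using (List; map; allFin; length)
open import Data.Nat.ListAction using (sum)
open import Data.List.Membership.Propositional using (_∈_)
open import Data.List.Relation.Unary.Unique.Propositional using (Unique)
open import Data.Product using (Σ; _×_; ∃; ∃-syntax)
open import Function.Definitions using (Injective)
open import Relation.Binary.PropositionalEquality using (_≡_)
open import Relation.Nullary using (¬_)

record Graph : Set where
  field
    order : ℕ
    adj   : Fin order → Fin order → Bool
    sym   : ∀ u v → adj u v ≡ adj v u
    irrefl : ∀ v → adj v v ≡ false
open Graph public

degree : (G : Graph) → Fin (order G) → ℕ
degree G v = sum (map (λ u → if adj G v u then 1 else 0) (allFin (order G)))

IsMinDegree : Graph → ℕ → Set
IsMinDegree G δ = (∀ v → δ ≤ degree G v) × (∃[ v ] degree G v ≡ δ)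

⌈_/_⌉ : ℕ → (d : ℕ) → .{{NonZero d}} → ℕ
⌈ n / d ⌉ = (n + d ∸ 1) / d

Coloring : Graph → Set
Coloring H = Fin (order H) → ℕ

ClassContains : (G H : Graph) → Coloring H → ℕ → Set
ClassContains G H c i =
  Σ (Fin (order G) → Fin (order H)) λ f →
    Injective _≡_ _≡_ f
    × (∀ u → c (f u) ≡ i)
    × (∀ u v → adj G u v ≡ true → adj H (f u) (f v) ≡ true)

IsGFreeColoring : (G H : Graph) → Coloring H → Set
IsGFreeColoring G H c = ∀ i → ¬ ClassContains G H c i

ListAssignment : Graph → Set
ListAssignment H = Fin (order H) → List ℕ

IsLGFreeColoring : (G H : Graph) → ListAssignment H → Coloring H → Set
IsLGFreeColoring G H L c = (∀ v → c v ∈ L v) × IsGFreeColoring G H c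

-- χ_G^L(H) ≤ k : every list assignment with all |L(v)| ≥ k admits an L-G-free coloring.
-- (Equivalent to the "least k" definition since the property is monotone in k.)
ListGChromatic≤ : (G H : Graph) → ℕ → Set
ListGChromatic≤ G H k =
  (L : ListAssignment H) →
  (∀ v → Unique (L v)) →
  (∀ v → k ≤ length (L v)) →
  ∃[ c ] IsLGFreeColoring G H L c

-- Colour the vertices of H greedily in the order 0, 1, …, n − 1, giving each
-- vertex a colour from its list that has so far been used fewer than δ times.
-- Such a colour exists: the earlier vertices number fewer than n ≤ ⌈n/δ⌉·δ,
-- while colours used at least δ times each would need |L(v)|·δ ≥ ⌈n/δ⌉·δ of
-- them. Hence every colour class has at most δ vertices, whereas G has a
-- vertex of degree δ and therefore more than δ vertices.
module Submission where

open import Defs hiding (sym)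
open import Data.Nat using (ℕ; zero; suc; _+_; _*_; _∸_; _≤_; _<_; NonZero; z≤n; s≤s; s≤s⁻¹; _≟_; _<?_)
open import Data.Nat.Properties
open import Data.Nat.DivMod using (_/_; _%_; m≡m%n+[m/n]*n; m%n<n)
open import Data.Nat.ListAction using (sum)
open import Data.Bool using (true; false; if_then_else_)
open import Data.Fin using (Fin; toℕ; fromℕ<)
open import Data.Fin.Properties using (toℕ<n; toℕ-injective; fromℕ<-toℕ; toℕ-fromℕ<; fromℕ<-injective; injective⇒≤)
open import Data.List using (List; []; _∷_; map; allFin; length)
open import Data.List.Properties using (length-tabulate)
open import Data.List.Membership.Propositional using (_∈_; find)
open import Data.List.Membership.Propositional.Properties using (∈-allFin)
open import Data.List.Relation.Unary.All as All using (All; []; _∷_)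
open import Data.List.Relation.Unary.All.Properties using (¬Any⇒All¬)
open import Data.List.Relation.Unary.Any as Any using (Any; here; there; any?)
open import Data.List.Relation.Unary.AllPairs using ([]; _∷_)
open import Data.List.Relation.Unary.Unique.Propositional using (Unique)
open import Data.Product using (∃; _×_; _,_; proj₁; proj₂)
open import Data.Sum using (inj₁; inj₂)
open import Function.Definitions using (Injective)
open import Relation.Binary.Definitions using (tri<; tri≈; tri>)
open import Relation.Binary.PropositionalEquality using (_≡_; _≢_; refl; cong; cong₂; subst; subst₂; sym; trans)
open import Relation.Nullary using (yes; no; contradiction)

occurrences : List ℕ → ℕ → ℕ
occurrences []       c = 0
occurrences (x ∷ xs) c with x ≟ c
... | yes _ = suc (occurrences xs c)
... | no  _ = occurrences xs c

occurrences-∷-≡ : ∀ c xs → occurrences (c ∷ xs) c ≡ suc (occurrences xs c)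
occurrences-∷-≡ c xs with c ≟ c
... | yes _   = refl
... | no  c≢c = contradiction refl c≢c

occurrences-∷-≢ : ∀ {x c} xs → x ≢ c → occurrences (x ∷ xs) c ≡ occurrences xs c
occurrences-∷-≢ {x} {c} xs x≢c with x ≟ c
... | yes x≡c = contradiction x≡c x≢c
... | no  _   = refl

occurrences-∷-≤ : ∀ x xs c → occurrences xs c ≤ occurrences (x ∷ xs) c
occurrences-∷-≤ x xs c with x ≟ c
... | yes _ = n≤1+n _
... | no  _ = ≤-refl

sum-occurrences-∷-fresh : ∀ {x} xs {cs} → All (x ≢_) cs →
                          sum (map (occurrences (x ∷ xs)) cs) ≡ sum (map (occurrences xs) cs)
sum-occurrences-∷-fresh xs []             = refl
sum-occurrences-∷-fresh xs (x≢c ∷ x∉cs) =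
  cong₂ _+_ (occurrences-∷-≢ xs x≢c) (sum-occurrences-∷-fresh xs x∉cs)

sum-occurrences-∷ : ∀ x xs {cs} → Unique cs →
                    sum (map (occurrences (x ∷ xs)) cs) ≤ suc (sum (map (occurrences xs) cs))
sum-occurrences-∷ x xs []                       = z≤n
sum-occurrences-∷ x xs {c ∷ cs} (c∉cs ∷ cs-unique) with x ≟ c
... | yes refl = s≤s (≤-reflexive (cong (occurrences xs x +_) (sum-occurrences-∷-fresh xs c∉cs)))
... | no  _    = ≤-trans (+-monoʳ-≤ (occurrences xs c) (sum-occurrences-∷ x xs cs-unique))
                         (≤-reflexive (+-suc (occurrences xs c) _))

sum-occurrences≤length : ∀ xs {cs} → Unique cs → sum (map (occurrences xs) cs) ≤ length xs
sum-occurrences≤length []       {[]}     _                = z≤n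
sum-occurrences≤length []       {c ∷ cs} (_ ∷ cs-unique)  = sum-occurrences≤length [] cs-unique
sum-occurrences≤length (x ∷ xs) cs-unique =
  ≤-trans (sum-occurrences-∷ x xs cs-unique) (s≤s (sum-occurrences≤length xs cs-unique))

length*δ≤sum : ∀ {δ} (f : ℕ → ℕ) {cs} → All (λ c → δ ≤ f c) cs → length cs * δ ≤ sum (map f cs)
length*δ≤sum f []          = z≤n
length*δ≤sum f (δ≤fc ∷ δ≤f) = +-mono-≤ δ≤fc (length*δ≤sum f δ≤f)

rare-colour : ∀ δ xs {cs} → Unique cs → length xs < length cs * δ →
              Any (λ c → occurrences xs c < δ) cs
rare-colour δ xs {cs} cs-unique xs-short with any? (λ c → occurrences xs c <? δ) cs
... | yes rare = rare
... | no  none = contradiction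
  (≤-trans (length*δ≤sum (occurrences xs) (All.map ≮⇒≥ (¬Any⇒All¬ cs none)))
           (sum-occurrences≤length xs cs-unique))
  (<⇒≱ xs-short)

m≤⌈m/n⌉*n : ∀ m n .{{_ : NonZero n}} → m ≤ ⌈ m / n ⌉ * n
m≤⌈m/n⌉*n m n@(suc k) = +-cancelʳ-≤ k m (⌈ m / n ⌉ * n) (begin
  m + k                             ≡⟨ cong (_∸ 1) (+-suc m k) ⟨
  m + n ∸ 1                         ≡⟨ m≡m%n+[m/n]*n (m + n ∸ 1) n ⟩
  (m + n ∸ 1) % n + ⌈ m / n ⌉ * n   ≤⟨ +-monoˡ-≤ _ (s≤s⁻¹ (m%n<n (m + n ∸ 1) n)) ⟩
  k + ⌈ m / n ⌉ * n                 ≡⟨ +-comm k _ ⟩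
  ⌈ m / n ⌉ * n + k                 ∎)
  where open ≤-Reasoning

sum<length : ∀ {A : Set} (f : A → ℕ) {xs} → (∀ x → f x ≤ 1) →
             Any (λ x → f x ≡ 0) xs → sum (map f xs) < length xs
sum<length f {x ∷ xs} f≤1 (here fx≡0) rewrite fx≡0 = s≤s (sum≤length xs)
  where
  sum≤length : ∀ xs → sum (map f xs) ≤ length xs
  sum≤length []       = z≤n
  sum≤length (y ∷ ys) = +-mono-≤ (f≤1 y) (sum≤length ys)
sum<length f {x ∷ xs} f≤1 (there zero∈xs) =
  subst (_≤ suc (length xs)) (+-suc (f x) _) (+-mono-≤ (f≤1 x) (sum<length f f≤1 zero∈xs))

degree<order : (G : Graph) (v : Fin (order G)) → degree G v < order G
degree<order G v = subst (degree G v <_) (length-tabulate (λ u → u))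
  (sum<length adjacent adjacent≤1 (Any.map (λ v≡u → subst (λ w → adjacent w ≡ 0) v≡u v-not-adjacent)
                                           (∈-allFin v)))
  where
  adjacent : Fin (order G) → ℕ
  adjacent u = if adj G v u then 1 else 0
  adjacent≤1 : ∀ u → adjacent u ≤ 1
  adjacent≤1 u with adj G v u
  ... | true  = ≤-refl
  ... | false = z≤n
  v-not-adjacent : adjacent v ≡ 0
  v-not-adjacent rewrite irrefl G v = refl

minDegree<order : ∀ G {δ} → IsMinDegree G δ → δ < order G
minDegree<order G (_ , v , deg≡δ) = subst (_< order G) deg≡δ (degree<order G v)

module GreedyColouring {n : ℕ} (δ : ℕ) (Λ : Fin n → List ℕ)
                       (Λ-unique : ∀ v → Unique (Λ v))
                       (Λ-large : ∀ v → toℕ v < length (Λ v) * δ) where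

  mutual
    -- the colours of vertices i − 1, …, 1, 0, in this order
    history : (i : ℕ) → .(i ≤ n) → List ℕ
    history zero    _   = []
    history (suc i) i<n = proj₁ (choice i i<n) ∷ history i (<⇒≤ i<n)

    choice : (i : ℕ) .(i<n : i < n) →
             ∃ λ c → c ∈ Λ (fromℕ< i<n) × occurrences (history i (<⇒≤ i<n)) c < δ
    choice i i<n = find (rare-colour δ (history i (<⇒≤ i<n)) (Λ-unique (fromℕ< i<n)) room)
      where
      room : length (history i (<⇒≤ i<n)) < length (Λ (fromℕ< i<n)) * δ
      room = subst₂ _<_ (trans (toℕ-fromℕ< i<n) (sym (length-history i (<⇒≤ i<n))))
                        refl (Λ-large (fromℕ< i<n))

    length-history : ∀ i .(i≤n : i ≤ n) → length (history i i≤n) ≡ i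
    length-history zero    _   = refl
    length-history (suc i) i<n = cong suc (length-history i (<⇒≤ i<n))

  colour : Fin n → ℕ
  colour v = proj₁ (choice (toℕ v) (toℕ<n v))

  colour-∈ : ∀ v → colour v ∈ Λ v
  colour-∈ v = subst (λ w → colour v ∈ Λ w) (fromℕ<-toℕ v (toℕ<n v))
                     (proj₁ (proj₂ (choice (toℕ v) (toℕ<n v))))

  earlier : Fin n → List ℕ
  earlier v = history (toℕ v) (<⇒≤ (toℕ<n v))

  rank : Fin n → ℕ
  rank v = occurrences (earlier v) (colour v)

  rank<δ : ∀ v → rank v < δ
  rank<δ v = proj₂ (proj₂ (choice (toℕ v) (toℕ<n v)))

  occurrences-history-mono : ∀ c {i j} .(i≤n : i ≤ n) .(j≤n : j ≤ n) → i ≤ j →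
                             occurrences (history i i≤n) c ≤ occurrences (history j j≤n) c
  occurrences-history-mono c {j = zero}  _ _   z≤n = ≤-refl
  occurrences-history-mono c {j = suc j} i≤n j<n i≤1+j with m≤n⇒m<n∨m≡n i≤1+j
  ... | inj₂ refl       = ≤-refl
  ... | inj₁ (s≤s i≤j) = ≤-trans (occurrences-history-mono c i≤n (<⇒≤ j<n) i≤j)
                                 (occurrences-∷-≤ (proj₁ (choice j j<n)) (history j (<⇒≤ j<n)) c)

  rank-< : ∀ {u w} → colour u ≡ colour w → toℕ u < toℕ w → rank u < rank w
  rank-< {u} {w} same-colour u<w = begin
    suc (rank u)                                  ≡⟨ occurrences-∷-≡ (colour u) (earlier u) ⟨
    occurrences (colour u ∷ earlier u) (colour u) ≤⟨ occurrences-history-mono (colour u) (toℕ<n u) _ u<w ⟩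
    occurrences (earlier w) (colour u)            ≡⟨ cong (occurrences (earlier w)) same-colour ⟩
    rank w                                        ∎
    where open ≤-Reasoning

  rank-injective-on-colour-class : ∀ {u w} → colour u ≡ colour w → rank u ≡ rank w → u ≡ w
  rank-injective-on-colour-class {u} {w} same-colour same-rank with <-cmp (toℕ u) (toℕ w)
  ... | tri< u<w _ _ = contradiction same-rank (<⇒≢ (rank-< same-colour u<w))
  ... | tri≈ _ u≡w _ = toℕ-injective u≡w
  ... | tri> _ _ w<u = contradiction (sym same-rank) (<⇒≢ (rank-< (sym same-colour) w<u))

  colour-class-size≤δ : ∀ {m c} (f : Fin m → Fin n) → Injective _≡_ _≡_ f →
                        (∀ u → colour (f u) ≡ c) → m ≤ δ
  colour-class-size≤δ f f-injective f-in-class = injective⇒≤ rank∘f-injective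
    where
    rank∘f-injective : Injective _≡_ _≡_ (λ u → fromℕ< (rank<δ (f u)))
    rank∘f-injective {u} {w} same = f-injective (rank-injective-on-colour-class
      (trans (f-in-class u) (sym (f-in-class w)))
      (fromℕ<-injective _ _ (rank<δ (f u)) (rank<δ (f w)) same))

lemma3 : (H G : Graph) (δ : ℕ) .{{_ : NonZero δ}} →
         IsMinDegree G δ →
         ListGChromatic≤ G H ⌈ order H / δ ⌉
lemma3 H G δ δ-min L L-unique L-large = colour , colour-∈ , colour-G-free
  where
  n = order H

  room : ∀ v → toℕ v < length (L v) * δ
  room v = begin-strict
    toℕ v              <⟨ toℕ<n v ⟩
    n                  ≤⟨ m≤⌈m/n⌉*n n δ ⟩
    ⌈ n / δ ⌉ * δ      ≤⟨ *-monoˡ-≤ δ (L-large v) ⟩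
    length (L v) * δ   ∎
    where open ≤-Reasoning

  open GreedyColouring δ L L-unique room

  colour-G-free : IsGFreeColoring G H colour
  colour-G-free c (f , f-injective , f-in-class , _) =
    <⇒≱ (minDegree<order G δ-min) (colour-class-size≤δ f f-injective f-in-class)
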